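{- The operators $u_1,u_2,\dots$ on $\mathbf{k}[\mathcal{P}]$ satisfy the Knuth relations: (1) $u_ju_iu_k=u_ju_ku_i$ for all $i\ge j>k$; (2) $u_iu_ku_j=u_ku_iu_j$ for all $i>j\ge k$; (3) $(u_i+u_{i+1})u_{i+1}u_i=u_{i+1}u_i(u_i+u_{i+1})$ for all $i\ge1$.
   Context: Let $\mathbf{k}$ be a field of characteristic $0$ containing parameters $\beta_1,\beta_2,\dots$. Let $\mathcal{P}$ be the set of partitions, regarded as infinite weakly decreasing sequences of nonnegative integers with finitely many nonzero terms, and $\mathbf{k}[\mathcal{P}]$ the vector space with basis $\mathcal{P}$. For $j\ge1$ define the linear operator $u_j$ (the pushing operator $u_j^{(0,\boldsymbol{\beta})}$) by: for a partition $\mu$, let $k\le j$ be minimal with $\mu_k=\mu_j$, let $\nu$ be the partition obtained from $\mu$ by adding one box to each of the rows $k,k+1,\dots,j$, and set $u_j\cdot\mu=\beta_k\beta_{k+1}\cdots\beta_{j-1}\,\nu$ (empty product $=1$ when $k=j$). -}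

module Defs where

open import Level using (Level)
open import Data.Nat using (ℕ; zero; suc; _∸_; _≤_; _≥_; _<_)
import Data.Nat as ℕ
open import Data.List using (List; []; _∷_; map; _++_)
open import Data.List.Relation.Unary.All using (All)
open import Data.List.Relation.Unary.Linked using (Linked)
open import Data.List.Properties using (≡-dec)
open import Data.Product using (_×_; _,_; proj₂; ∃)
open import Relation.Nullary using (¬_; yes; no)
open import Algebra.Bundles using (CommutativeRing)

-- Partitions: finite lists of positive integers, weakly decreasing
-- (the infinite sequence with its trailing zeros dropped).
IsPartition : List ℕ → Set
IsPartition μ = All (λ x → 1 ≤ x) μ × Linked _≥_ μ

-- μ_r for 1-based row index r (rows beyond the length are 0; μ_0 unused)
row : ℕ → List ℕ → ℕ
row r μ = go (r ∸ 1) μ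
  where
  go : ℕ → List ℕ → ℕ
  go _ [] = 0
  go zero (x ∷ _) = x
  go (suc n) (_ ∷ xs) = go n xs

addAt : ℕ → List ℕ → List ℕ
addAt r μ = go (r ∸ 1) μ
  where
  go : ℕ → List ℕ → List ℕ
  go zero [] = 1 ∷ []
  go zero (x ∷ xs) = suc x ∷ xs
  go (suc n) [] = 0 ∷ go n []
  go (suc n) (x ∷ xs) = x ∷ go n xs

minRow : ℕ → List ℕ → ℕ
minRow j μ = go 1 (j ∸ 1)
  where
  go : ℕ → ℕ → ℕ
  go r zero = r
  go r (suc n) with row r μ ℕ.≟ row j μ
  ... | yes _ = r
  ... | no _ = go (suc r) n

pushFrom : ℕ → ℕ → List ℕ → List ℕ
pushFrom r zero μ = μ
pushFrom r (suc n) μ = pushFrom (suc r) n (addAt r μ)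

push : ℕ → List ℕ → List ℕ
push j μ = pushFrom (minRow j μ) (suc (j ∸ minRow j μ)) μ

module _ {c ℓ : Level} (R : CommutativeRing c ℓ) where
  open CommutativeRing R

  fromℕ : ℕ → Carrier
  fromℕ zero = 0#
  fromℕ (suc n) = 1# + fromℕ n

  IsField : Set (c Level.⊔ ℓ)
  IsField = (¬ (1# ≈ 0#)) × (∀ x → ¬ (x ≈ 0#) → ∃ λ y → x * y ≈ 1#)

  CharZero : Set ℓ
  CharZero = ∀ n → ¬ (fromℕ (suc n) ≈ 0#)

module KP {c ℓ : Level} (R : CommutativeRing c ℓ) (β : ℕ → CommutativeRing.Carrier R) where
  open CommutativeRing R

  -- an element of k[P] is a formal sum Σ c_μ μ, represented by a list of terms
  Vect : Set c
  Vect = List (Carrier × List ℕ)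

  IsVect : Vect → Set c
  IsVect v = All (λ t → IsPartition (proj₂ t)) v

  coeff : List ℕ → Vect → Carrier
  coeff λ' [] = 0#
  coeff λ' ((a , μ) ∷ v) with ≡-dec ℕ._≟_ μ λ'
  ... | yes _ = a + coeff λ' v
  ... | no _ = coeff λ' v

  _≋_ : Vect → Vect → Set ℓ
  v ≋ w = ∀ λ' → IsPartition λ' → coeff λ' v ≈ coeff λ' w

  prodFrom : ℕ → ℕ → Carrier
  prodFrom r zero = 1#
  prodFrom r (suc n) = β r * prodFrom (suc r) n

  u : ℕ → Vect → Vect
  u j = map (λ { (a , μ) → (a * prodFrom (minRow j μ) (j ∸ minRow j μ) , push j μ) })

  _⊕_ : (Vect → Vect) → (Vect → Vect) → Vect → Vect
  (f ⊕ g) v = f v ++ g v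

-- Record a partition by its column lengths, longest first.  Adding one box to each of
-- the rows k, …, j with k minimal such that μ_k = μ_j turns the first column of μ
-- shorter than j, of length x say (x = 0 if there is none), into a column of length
-- j; then k = x + 1 and the coefficient is β_{x+1} ⋯ β_{j-1}.  So u_j acts on column
-- lists by a weighted column insertion, and the Knuth relations hold term by term.
-- Columns at least as long as all letters are never touched, so only the first one or
-- two columns the letters reach matter, and there the coefficients agree because
-- β_{x+1} ⋯ β_{j-1} splits at any intermediate index.  Relation (3) is the sum of the
-- instance (i+1, i, i) of (2) and the instance (i+1, i+1, i) of (1).
module Submission where

open import Defs
open import Level using (Level; _⊔_)
open import Data.Nat
  using (ℕ; zero; suc; pred; _+_; _∸_; _≤_; _≥_; _<_; z≤n; s≤s; s≤s⁻¹; _≟_; _<?_; _≤?_)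
  renaming (_⊔_ to _⊔ℕ_)
open import Data.Nat.Properties
  using (≤-refl; ≤-reflexive; ≤-trans; ≤-antisym; <⇒≤; <⇒≱; ≮⇒≥; ≰⇒>; ≤∧≢⇒<;
         <-trans; <-≤-trans; ≤-<-trans; n≤1+n; n<1+n; m≤m+n; suc-injective; 1+n≢0;
         pred-mono-≤; +-suc; +-assoc; +-identityʳ; m+n∸m≡n; m+[n∸m]≡n; m≤n⇒∃[o]m+o≡n;
         m≤m⊔n; ⊔-lub; ⊔-identityʳ; m≤n⇒m⊔n≡n; m≥n⇒m⊔n≡m)
open import Data.List using (List; []; _∷_; length; map; _++_)
open import Data.List.Properties using (map-id; map-∘; map-++; ≡-dec)
open import Data.List.Relation.Unary.All as All using (All; []; _∷_)
open import Data.List.Relation.Unary.Linked using (Linked; []; [-]; _∷_)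
open import Data.Product using (_×_; _,_; proj₁; proj₂; map₂; ∃)
open import Data.Unit using (⊤; tt)
open import Data.Empty using (⊥-elim)
open import Relation.Nullary using (Dec; yes; no)
open import Relation.Binary.PropositionalEquality as ≡ using (_≡_; _≢_; cong; cong₂; subst)
open import Algebra.Bundles using (CommutativeRing)

row-pastEnd : ∀ r μ → length μ ≤ r → row (suc r) μ ≡ 0
row-pastEnd r [] _ = ≡.refl
row-pastEnd zero (_ ∷ _) ()
row-pastEnd (suc r) (_ ∷ μ) (s≤s p) = row-pastEnd r μ p

-- `minRow` searches with a local function that is out of scope here; solving the
-- meta below by unification makes it available as `minRowSearch j μ r n`, the first
-- row among r, r+1, …, r+n-1 equal to row j, or r+n if there is none.
mutual
  minRowSearch : ℕ → List ℕ → ℕ → ℕ → ℕ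
  minRowSearch j μ = _

  minRow≡minRowSearch : ∀ j μ → minRow j μ ≡ minRowSearch j μ 1 (j ∸ 1)
  minRow≡minRowSearch j μ with 1 | j ∸ 1
  ... | _ | _ = ≡.refl

module _ (j : ℕ) (μ : List ℕ) where

  search-here : ∀ {r} n → row r μ ≡ row j μ → minRowSearch j μ r (suc n) ≡ r
  search-here {r} n eq with row r μ ≟ row j μ
  ... | yes _ = ≡.refl
  ... | no ne = ⊥-elim (ne eq)

  search-next : ∀ {r} n → row r μ ≢ row j μ →
                minRowSearch j μ r (suc n) ≡ minRowSearch j μ (suc r) n
  search-next {r} n ne with row r μ ≟ row j μ
  ... | yes eq = ⊥-elim (ne eq)
  ... | no _ = ≡.refl

  search-bounds : ∀ r n → r ≤ minRowSearch j μ r n × minRowSearch j μ r n ≤ r + n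
  search-bounds r zero = ≤-refl , m≤m+n r 0
  search-bounds r (suc n) with row r μ ≟ row j μ
  ... | yes _ = ≤-refl , m≤m+n r (suc n)
  ... | no _ with search-bounds (suc r) n
  ...   | lo , hi = ≤-trans (n≤1+n r) lo , ≤-trans hi (≤-reflexive (≡.sym (+-suc r n)))

  search-firstZero : ∀ x → (∀ r → r < x → row (suc r) μ ≢ 0) → row (suc x) μ ≡ 0 →
                     row j μ ≡ 0 → ∀ r n → r ≤ x → x ≤ r + n →
                     minRowSearch j μ (suc r) n ≡ suc x
  search-firstZero x _ _ _ r zero r≤x x≤r =
    cong suc (≤-antisym r≤x (subst (x ≤_) (+-identityʳ r) x≤r))
  search-firstZero x nonzero zero-x zero-j r (suc n) r≤x x≤r+n with r ≟ x
  ... | yes ≡.refl = search-here n (≡.trans zero-x (≡.sym zero-j))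
  ... | no r≢x = ≡.trans (search-next n (λ eq → nonzero r r<x (≡.trans eq zero-j)))
                         (search-firstZero x nonzero zero-x zero-j (suc r) n r<x
                                           (subst (x ≤_) (+-suc r n) x≤r+n))
    where
    r<x : r < x
    r<x = ≤∧≢⇒< r≤x r≢x

minRow-≥1 : ∀ j μ → 1 ≤ minRow j μ
minRow-≥1 j μ = proj₁ (search-bounds j μ 1 (j ∸ 1))

minRow-≤ : ∀ {j} μ → 1 ≤ j → minRow j μ ≤ j
minRow-≤ {suc j} μ _ = proj₂ (search-bounds (suc j) μ 1 j)

minRow-firstZero : ∀ {j μ} x → x < j → (∀ r → r < x → row (suc r) μ ≢ 0) →
                   row (suc x) μ ≡ 0 → row j μ ≡ 0 → minRow j μ ≡ suc x
minRow-firstZero {suc j} {μ} x (s≤s x≤j) nonzero zero-x zero-j =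
  search-firstZero (suc j) μ x nonzero zero-x zero-j 0 j z≤n x≤j

minRow-shift : ∀ j μ₁ μ₂ → (∀ r → r < j → row (suc r) μ₁ ≡ suc (row (suc r) μ₂)) →
               minRow j μ₁ ≡ minRow j μ₂
minRow-shift zero _ _ _ = ≡.refl
minRow-shift (suc j) μ₁ μ₂ shift = go 0 j ≤-refl
  where
  go : ∀ r n → r + n ≤ j → minRowSearch (suc j) μ₁ (suc r) n ≡ minRowSearch (suc j) μ₂ (suc r) n
  go r zero _ = ≡.refl
  go r (suc n) le = by-cases (row (suc r) μ₂ ≟ row (suc j) μ₂)
    where
    r<j : r < suc j
    r<j = s≤s (≤-trans (m≤m+n r (suc n)) le)
    by-cases : Dec (row (suc r) μ₂ ≡ row (suc j) μ₂) →
               minRowSearch (suc j) μ₁ (suc r) (suc n) ≡ minRowSearch (suc j) μ₂ (suc r) (suc n)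
    by-cases (yes eq) =
      ≡.trans (search-here (suc j) μ₁ n (≡.trans (shift r r<j) (≡.trans (cong suc eq) (≡.sym (shift j ≤-refl)))))
              (≡.sym (search-here (suc j) μ₂ n eq))
    by-cases (no ne) =
      ≡.trans (search-next (suc j) μ₁ n (λ eq → ne (suc-injective (≡.trans (≡.sym (shift r r<j))
                                                                          (≡.trans eq (shift j ≤-refl))))))
              (≡.trans (go (suc r) n (subst (_≤ j) (+-suc r n) le)) (≡.sym (search-next (suc j) μ₂ n ne)))

hd : List ℕ → ℕ
hd [] = 0
hd (x ∷ _) = x

tl : List ℕ → List ℕ
tl [] = []
tl (_ ∷ L) = L

Decreasing : List ℕ → Set
Decreasing [] = ⊤
Decreasing (x ∷ L) = hd L ≤ x × Decreasing L

-- `addCol x ν` puts a column of length x in front of ν (a partition when length ν ≤ x),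
-- so `fromCols L` is the partition whose column lengths are L.
addCol : ℕ → List ℕ → List ℕ
addCol zero ν = ν
addCol (suc x) [] = 1 ∷ addCol x []
addCol (suc x) (a ∷ ν) = suc a ∷ addCol x ν

fromCols : List ℕ → List ℕ
fromCols [] = []
fromCols (x ∷ L) = addCol x (fromCols L)

row-addCol : ∀ r x ν → r < x → row (suc r) (addCol x ν) ≡ suc (row (suc r) ν)
row-addCol zero (suc x) [] _ = ≡.refl
row-addCol zero (suc x) (a ∷ ν) _ = ≡.refl
row-addCol (suc r) (suc x) [] (s≤s r<x) = row-addCol r x [] r<x
row-addCol (suc r) (suc x) (a ∷ ν) (s≤s r<x) = row-addCol r x ν r<x

length-addCol : ∀ x ν → length ν ≤ x → length (addCol x ν) ≡ x
length-addCol zero [] _ = ≡.refl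
length-addCol (suc x) [] _ = cong suc (length-addCol x [] z≤n)
length-addCol (suc x) (a ∷ ν) (s≤s p) = cong suc (length-addCol x ν p)

length-fromCols : ∀ L → Decreasing L → length (fromCols L) ≡ hd L
length-fromCols [] _ = ≡.refl
length-fromCols (x ∷ L) (h , d) =
  length-addCol x (fromCols L) (subst (_≤ x) (≡.sym (length-fromCols L d)) h)

addAt-addCol : ∀ r x ν → r < x → addAt (suc r) (addCol x ν) ≡ addCol x (addAt (suc r) ν)
addAt-addCol zero (suc x) [] _ = ≡.refl
addAt-addCol zero (suc x) (a ∷ ν) _ = ≡.refl
addAt-addCol (suc r) (suc x) [] (s≤s r<x) = cong (1 ∷_) (addAt-addCol r x [] r<x)
addAt-addCol (suc r) (suc x) (a ∷ ν) (s≤s r<x) = cong (suc a ∷_) (addAt-addCol r x ν r<x)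

addAt-growCol : ∀ x ν → length ν ≤ x → addAt (suc x) (addCol x ν) ≡ addCol (suc x) ν
addAt-growCol zero [] _ = ≡.refl
addAt-growCol (suc x) [] _ = cong (1 ∷_) (addAt-growCol x [] z≤n)
addAt-growCol (suc x) (a ∷ ν) (s≤s p) = cong (suc a ∷_) (addAt-growCol x ν p)

pushFrom-addCol : ∀ r n x ν → 1 ≤ r → r + n ≤ suc x →
                  pushFrom r n (addCol x ν) ≡ addCol x (pushFrom r n ν)
pushFrom-addCol r zero x ν _ _ = ≡.refl
pushFrom-addCol (suc r) (suc n) x ν _ le =
  ≡.trans (cong (pushFrom (suc (suc r)) n) (addAt-addCol r x ν r<x))
          (pushFrom-addCol (suc (suc r)) n x (addAt (suc r) ν) (s≤s z≤n) le′)
  where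
  le′ : suc (suc r) + n ≤ suc x
  le′ = subst (_≤ suc x) (cong suc (+-suc r n)) le
  r<x : r < x
  r<x = s≤s⁻¹ (≤-trans (s≤s (s≤s (m≤m+n r n))) le′)

pushFrom-growCol : ∀ n x ν → length ν ≤ x → pushFrom (suc x) n (addCol x ν) ≡ addCol (x + n) ν
pushFrom-growCol zero x ν _ = cong (λ y → addCol y ν) (≡.sym (+-identityʳ x))
pushFrom-growCol (suc n) x ν p = begin
  pushFrom (suc (suc x)) n (addAt (suc x) (addCol x ν))
    ≡⟨ cong (pushFrom (suc (suc x)) n) (addAt-growCol x ν p) ⟩
  pushFrom (suc (suc x)) n (addCol (suc x) ν)
    ≡⟨ pushFrom-growCol n (suc x) ν (≤-trans p (n≤1+n x)) ⟩
  addCol (suc x + n) ν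
    ≡⟨ cong (λ y → addCol y ν) (≡.sym (+-suc x n)) ⟩
  addCol (x + suc n) ν
    ∎
  where open ≡.≡-Reasoning

minRow-addCol-< : ∀ {j x} ν → x < j → length ν ≤ x → minRow j (addCol x ν) ≡ suc x
minRow-addCol-< {suc j} {x} ν (s≤s x≤j) p =
  minRow-firstZero x (s≤s x≤j) (λ r r<x eq → 1+n≢0 (≡.trans (≡.sym (row-addCol r x ν r<x)) eq))
    (row-pastEnd x (addCol x ν) (≤-reflexive length-μ))
    (row-pastEnd j (addCol x ν) (≤-trans (≤-reflexive length-μ) x≤j))
  where
  length-μ : length (addCol x ν) ≡ x
  length-μ = length-addCol x ν p

minRow-addCol-≥ : ∀ {j x} ν → j ≤ x → minRow j (addCol x ν) ≡ minRow j ν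
minRow-addCol-≥ {j} {x} ν j≤x =
  minRow-shift j _ _ (λ r r<j → row-addCol r x ν (<-≤-trans r<j j≤x))

push-addCol-< : ∀ {j x} ν → x < j → length ν ≤ x → push j (addCol x ν) ≡ addCol j ν
push-addCol-< {j} {x} ν x<j p rewrite minRow-addCol-< ν x<j p = begin
  pushFrom (suc x) (suc (j ∸ suc x)) (addCol x ν)
    ≡⟨ pushFrom-growCol (suc (j ∸ suc x)) x ν p ⟩
  addCol (x + suc (j ∸ suc x)) ν
    ≡⟨ cong (λ y → addCol y ν) (≡.trans (+-suc x _) (m+[n∸m]≡n x<j)) ⟩
  addCol j ν
    ∎
  where open ≡.≡-Reasoning

push-addCol-≥ : ∀ {j x} ν → 1 ≤ j → j ≤ x → push j (addCol x ν) ≡ addCol x (push j ν)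
push-addCol-≥ {j} {x} ν 1≤j j≤x rewrite minRow-addCol-≥ ν j≤x =
  pushFrom-addCol m (suc (j ∸ m)) x ν (minRow-≥1 j ν) fits
  where
  m = minRow j ν
  fits : m + suc (j ∸ m) ≤ suc x
  fits = subst (_≤ suc x) (≡.sym (≡.trans (+-suc m _) (cong suc (m+[n∸m]≡n (minRow-≤ ν 1≤j)))))
               (s≤s j≤x)

bump : ℕ → List ℕ → ℕ × List ℕ
bump j [] = 0 , j ∷ []
bump j (x ∷ L) with x <? j
... | yes _ = x , j ∷ L
... | no _ = map₂ (x ∷_) (bump j L)

bump-front : ∀ {j x} L → x < j → bump j (x ∷ L) ≡ (x , j ∷ L)
bump-front {j} {x} L x<j with x <? j
... | yes _ = ≡.refl
... | no x≮j = ⊥-elim (x≮j x<j)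

bump-skip : ∀ {j x} L → j ≤ x → bump j (x ∷ L) ≡ map₂ (x ∷_) (bump j L)
bump-skip {j} {x} L j≤x with x <? j
... | yes x<j = ⊥-elim (<⇒≱ x<j j≤x)
... | no _ = ≡.refl

bump-hd : ∀ {j} L → hd L < j → bump j L ≡ (hd L , j ∷ tl L)
bump-hd [] _ = ≡.refl
bump-hd (x ∷ L) x<j = bump-front L x<j

hd-bump : ∀ j L → hd (proj₂ (bump j L)) ≡ j ⊔ℕ hd L
hd-bump j [] = ≡.sym (⊔-identityʳ j)
hd-bump j (x ∷ L) with x <? j
... | yes x<j = ≡.sym (m≥n⇒m⊔n≡m (<⇒≤ x<j))
... | no x≮j = ≡.sym (m≤n⇒m⊔n≡n (≮⇒≥ x≮j))

bump-decreasing : ∀ j L → Decreasing L → Decreasing (proj₂ (bump j L))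
bump-decreasing j [] _ = z≤n , tt
bump-decreasing j (x ∷ L) (h , d) with x <? j
... | yes x<j = ≤-trans h (<⇒≤ x<j) , d
... | no x≮j = subst (_≤ x) (≡.sym (hd-bump j L)) (⊔-lub (≮⇒≥ x≮j) h) , bump-decreasing j L d

minRow-fromCols : ∀ {j} L → 1 ≤ j → Decreasing L → minRow j (fromCols L) ≡ suc (proj₁ (bump j L))
minRow-fromCols [] 1≤j _ = minRow-addCol-< [] 1≤j z≤n
minRow-fromCols {j} (x ∷ L) 1≤j (h , d) with x <? j
... | yes x<j = minRow-addCol-< (fromCols L) x<j (subst (_≤ x) (≡.sym (length-fromCols L d)) h)
... | no x≮j = ≡.trans (minRow-addCol-≥ (fromCols L) (≮⇒≥ x≮j)) (minRow-fromCols L 1≤j d)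

push-fromCols : ∀ {j} L → 1 ≤ j → Decreasing L → push j (fromCols L) ≡ fromCols (proj₂ (bump j L))
push-fromCols [] 1≤j _ = push-addCol-< [] 1≤j z≤n
push-fromCols {j} (x ∷ L) 1≤j (h , d) with x <? j
... | yes x<j = push-addCol-< (fromCols L) x<j (subst (_≤ x) (≡.sym (length-fromCols L d)) h)
... | no x≮j =
  ≡.trans (push-addCol-≥ (fromCols L) 1≤j (≮⇒≥ x≮j)) (cong (addCol x) (push-fromCols L 1≤j d))

removeCol : List ℕ → List ℕ
removeCol [] = []
removeCol (zero ∷ _) = []
removeCol (suc zero ∷ _) = []
removeCol (suc (suc a) ∷ μ) = suc a ∷ removeCol μ

hd-removeCol : ∀ μ → hd (removeCol μ) ≤ pred (hd μ)
hd-removeCol [] = z≤n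
hd-removeCol (zero ∷ _) = z≤n
hd-removeCol (suc zero ∷ _) = z≤n
hd-removeCol (suc (suc a) ∷ _) = ≤-refl

length-removeCol : ∀ μ → length (removeCol μ) ≤ length μ
length-removeCol [] = z≤n
length-removeCol (zero ∷ _) = z≤n
length-removeCol (suc zero ∷ _) = z≤n
length-removeCol (suc (suc a) ∷ μ) = s≤s (length-removeCol μ)

removeCol-positive : ∀ μ → All (1 ≤_) (removeCol μ)
removeCol-positive [] = []
removeCol-positive (zero ∷ _) = []
removeCol-positive (suc zero ∷ _) = []
removeCol-positive (suc (suc a) ∷ μ) = s≤s z≤n ∷ removeCol-positive μ

removeCol-decreasing : ∀ μ → Decreasing μ → Decreasing (removeCol μ)
removeCol-decreasing [] _ = tt
removeCol-decreasing (zero ∷ _) _ = tt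
removeCol-decreasing (suc zero ∷ _) _ = tt
removeCol-decreasing (suc (suc a) ∷ μ) (h , d) =
  ≤-trans (hd-removeCol μ) (pred-mono-≤ h) , removeCol-decreasing μ d

addCol-ones : ∀ μ → All (1 ≤_) μ → Decreasing μ → hd μ ≤ 1 → addCol (length μ) [] ≡ μ
addCol-ones [] _ _ _ = ≡.refl
addCol-ones (y ∷ μ) (1≤y ∷ ps) (h , d) y≤1 =
  cong₂ _∷_ (≤-antisym 1≤y y≤1) (addCol-ones μ ps d (≤-trans h y≤1))

addCol-removeCol : ∀ μ → All (1 ≤_) μ → Decreasing μ → addCol (length μ) (removeCol μ) ≡ μ
addCol-removeCol [] _ _ = ≡.refl
addCol-removeCol (suc zero ∷ μ) (_ ∷ ps) (h , d) = cong (1 ∷_) (addCol-ones μ ps d h)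
addCol-removeCol (suc (suc a) ∷ μ) (_ ∷ ps) (_ , d) = cong (suc (suc a) ∷_) (addCol-removeCol μ ps d)

fromCols-onto : ∀ n μ → hd μ ≤ n → All (1 ≤_) μ → Decreasing μ →
                ∃ λ L → Decreasing L × fromCols L ≡ μ
fromCols-onto _ [] _ _ _ = [] , tt , ≡.refl
fromCols-onto zero (y ∷ μ) y≤0 (1≤y ∷ _) _ = ⊥-elim (<⇒≱ 1≤y y≤0)
fromCols-onto (suc n) (y ∷ μ) y≤n ps d
  with fromCols-onto n (removeCol (y ∷ μ)) (≤-trans (hd-removeCol (y ∷ μ)) (pred-mono-≤ y≤n))
                     (removeCol-positive (y ∷ μ)) (removeCol-decreasing (y ∷ μ) d)
... | L , dL , eq =
  (length (y ∷ μ) ∷ L) , (hd-L , dL) , ≡.trans (cong (addCol _) eq) (addCol-removeCol (y ∷ μ) ps d)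
  where
  hd-L : hd L ≤ length (y ∷ μ)
  hd-L = subst (_≤ length (y ∷ μ)) (≡.trans (cong length (≡.sym eq)) (length-fromCols L dL))
               (length-removeCol (y ∷ μ))

Linked⇒Decreasing : ∀ {μ} → Linked _≥_ μ → Decreasing μ
Linked⇒Decreasing [] = tt
Linked⇒Decreasing [-] = z≤n , tt
Linked⇒Decreasing (y≤x ∷ l) = y≤x , Linked⇒Decreasing l

partition-fromCols : ∀ {μ} → IsPartition μ → ∃ λ L → Decreasing L × fromCols L ≡ μ
partition-fromCols {μ} (ps , l) = fromCols-onto (hd μ) μ ≤-refl ps (Linked⇒Decreasing l)

module _ {c ℓ : Level} (R : CommutativeRing c ℓ) (β : ℕ → CommutativeRing.Carrier R) where
  open CommutativeRing R hiding (+-identityʳ) renaming (_+_ to _+ᵣ_; +-assoc to +ᵣ-assoc)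
  open KP R β
  open import Algebra.Properties.CommutativeSemigroup *-commutativeSemigroup using (xy∙z≈xz∙y)
  open import Algebra.Solver.CommutativeMonoid *-commutativeMonoid
    using (solve; _⊜_) renaming (_⊕_ to _⊙_)
  open import Relation.Binary.Reasoning.Setoid setoid

  prodBetween : ℕ → ℕ → Carrier
  prodBetween x j = prodFrom (suc x) (j ∸ suc x)

  prodFrom-+ : ∀ r m n → prodFrom r (m + n) ≈ prodFrom r m * prodFrom (r + m) n
  prodFrom-+ r zero n = begin
    prodFrom r n            ≡⟨ cong (λ s → prodFrom s n) (≡.sym (+-identityʳ r)) ⟩
    prodFrom (r + 0) n      ≈⟨ sym (*-identityˡ _) ⟩
    1# * prodFrom (r + 0) n ∎
  prodFrom-+ r (suc m) n = begin
    β r * prodFrom (suc r) (m + n)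
      ≈⟨ *-congˡ (prodFrom-+ (suc r) m n) ⟩
    β r * (prodFrom (suc r) m * prodFrom (suc r + m) n)
      ≈⟨ sym (*-assoc _ _ _) ⟩
    (β r * prodFrom (suc r) m) * prodFrom (suc r + m) n
      ≈⟨ *-congˡ (reflexive (cong (λ s → prodFrom s n) (≡.sym (+-suc r m)))) ⟩
    (β r * prodFrom (suc r) m) * prodFrom (r + suc m) n
      ∎

  prodBetween-split : ∀ {x k j} → x < k → k < j →
                      prodBetween x j ≈ prodBetween x k * (β k * prodBetween k j)
  prodBetween-split {x} x<k k<j with m≤n⇒∃[o]m+o≡n x<k | m≤n⇒∃[o]m+o≡n k<j
  ... | p , ≡.refl | q , ≡.refl = begin
    prodFrom (suc x) (suc k + q ∸ suc x)
      ≡⟨ cong (prodFrom (suc x)) length-xj ⟩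
    prodFrom (suc x) (p + suc q)
      ≈⟨ prodFrom-+ (suc x) p (suc q) ⟩
    prodFrom (suc x) p * (β k * prodFrom (suc k) q)
      ≡⟨ cong₂ (λ a b → prodFrom (suc x) a * (β k * prodFrom (suc k) b))
               (≡.sym (m+n∸m≡n (suc x) p)) (≡.sym (m+n∸m≡n (suc k) q)) ⟩
    prodBetween x k * (β k * prodBetween k (suc k + q))
      ∎
    where
    k = suc x + p
    length-xj : suc k + q ∸ suc x ≡ p + suc q
    length-xj = ≡.trans (cong (_∸ suc x) (≡.trans (≡.sym (+-suc k q)) (+-assoc (suc x) p (suc q))))
                        (m+n∸m≡n (suc x) (p + suc q))

  insertCol : ℕ → Carrier × List ℕ → Carrier × List ℕ
  insertCol j (a , L) = a * prodBetween (proj₁ (bump j L)) j , proj₂ (bump j L)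

  insertWord : List ℕ → Carrier × List ℕ → Carrier × List ℕ
  insertWord [] X = X
  insertWord (j ∷ w) X = insertWord w (insertCol j X)

  _≅_ : Carrier × List ℕ → Carrier × List ℕ → Set ℓ
  (a , L) ≅ (b , M) = a ≈ b × L ≡ M

  SameInsertion : List ℕ → List ℕ → Set (c ⊔ ℓ)
  SameInsertion w w′ = ∀ a L → Decreasing L → insertWord w (a , L) ≅ insertWord w′ (a , L)

  insertCol-cong : ∀ j {X Y} → X ≅ Y → insertCol j X ≅ insertCol j Y
  insertCol-cong j (a≈b , ≡.refl) = *-congʳ a≈b , ≡.refl

  insertWord-skip : ∀ {x a L} w → All (_≤ x) w →
                    insertWord w (a , x ∷ L) ≡ map₂ (x ∷_) (insertWord w (a , L))
  insertWord-skip [] [] = ≡.refl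
  insertWord-skip {L = L} (j ∷ w) (j≤x ∷ ps) rewrite bump-skip {j} L j≤x = insertWord-skip w ps

  ≅-skip : ∀ {x a L} w w′ → All (_≤ x) w → All (_≤ x) w′ →
           insertWord w (a , L) ≅ insertWord w′ (a , L) →
           insertWord w (a , x ∷ L) ≅ insertWord w′ (a , x ∷ L)
  ≅-skip {x} {a} {L} w w′ ps ps′ (e , e′)
    rewrite insertWord-skip {x} {a} {L} w ps | insertWord-skip {x} {a} {L} w′ ps′ = e , cong (x ∷_) e′

  insertCol-commute : ∀ {i k b} M → 1 ≤ k → k ≤ hd M → hd M < i →
                      insertCol i (insertCol k (b , M)) ≅ insertCol k (insertCol i (b , M))
  insertCol-commute [] 1≤k k≤0 _ = ⊥-elim (<⇒≱ 1≤k k≤0)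
  insertCol-commute {i} {k} (x ∷ M) _ k≤x x<i
    rewrite bump-skip {k} M k≤x | bump-front (proj₂ (bump k M)) x<i
          | bump-front M x<i | bump-skip {k} M (≤-trans k≤x (<⇒≤ x<i))
    = xy∙z≈xz∙y _ _ _ , ≡.refl

  knuth₁-front : ∀ {i j k a} L → k < j → j ≤ i → hd L < k → hd (tl L) < k →
                 insertWord (k ∷ i ∷ j ∷ []) (a , L) ≅ insertWord (i ∷ k ∷ j ∷ []) (a , L)
  knuth₁-front {i} {j} {k} {a} L k<j j≤i h<k t<k
    rewrite bump-hd L h<k | bump-front (tl L) (<-≤-trans k<j j≤i)
          | bump-skip (tl L) j≤i | bump-hd (tl L) (<-trans t<k k<j)
          | bump-hd L (<-trans h<k (<-≤-trans k<j j≤i)) | bump-skip (tl L) (<⇒≤ (<-≤-trans k<j j≤i))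
          | bump-hd (tl L) t<k | bump-skip (k ∷ tl (tl L)) j≤i | bump-front (tl (tl L)) k<j
    = (begin
        ((a * P h k) * P k i) * P t j                        ≈⟨ *-congˡ (prodBetween-split t<k k<j) ⟩
        ((a * P h k) * P k i) * (P t k * (β k * P k j))      ≈⟨ rearrange a _ _ _ (β k) _ ⟩
        ((a * (P h k * (β k * P k i))) * P t k) * P k j      ≈⟨ *-congʳ (*-congʳ (*-congˡ (sym split-hi))) ⟩
        ((a * P h i) * P t k) * P k j                        ∎) , ≡.refl
    where
    P = prodBetween
    h = hd L
    t = hd (tl L)
    split-hi : P h i ≈ P h k * (β k * P k i)
    split-hi = prodBetween-split h<k (<-≤-trans k<j j≤i)
    rearrange : ∀ A B C D E F → ((A * B) * C) * (D * (E * F)) ≈ ((A * (B * (E * C))) * D) * F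
    rearrange = solve 6 (λ A B C D E F → ((A ⊙ B) ⊙ C) ⊙ (D ⊙ (E ⊙ F)) ⊜ ((A ⊙ (B ⊙ (E ⊙ C))) ⊙ D) ⊙ F)
                        refl

  knuth₁-columns : ∀ {i j k} → 1 ≤ k → k < j → j ≤ i →
                   SameInsertion (k ∷ i ∷ j ∷ []) (i ∷ k ∷ j ∷ [])
  knuth₁-columns 1≤k k<j j≤i a [] _ = knuth₁-front [] k<j j≤i 1≤k 1≤k
  knuth₁-columns {i} {j} {k} 1≤k k<j j≤i a (x ∷ L) (h , d) with k ≤? x | i ≤? x
  ... | no k≰x | _ = knuth₁-front (x ∷ L) k<j j≤i (≰⇒> k≰x) (≤-<-trans h (≰⇒> k≰x))
  ... | yes k≤x | no i≰x = insertCol-cong j (insertCol-commute (x ∷ L) 1≤k k≤x (≰⇒> i≰x))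
  ... | yes k≤x | yes i≤x =
    ≅-skip (k ∷ i ∷ j ∷ []) (i ∷ k ∷ j ∷ []) (k≤x ∷ i≤x ∷ j≤x ∷ []) (i≤x ∷ k≤x ∷ j≤x ∷ [])
           (knuth₁-columns 1≤k k<j j≤i a L d)
    where
    j≤x = ≤-trans j≤i i≤x

  knuth₂-columns : ∀ {i j k} → 1 ≤ k → k ≤ j → j < i →
                   SameInsertion (j ∷ k ∷ i ∷ []) (j ∷ i ∷ k ∷ [])
  knuth₂-columns {i} {j} {k} 1≤k k≤j j<i a L d with hd L <? i
  ... | yes h<i = insertCol-commute (proj₂ (bump j L)) 1≤k
                    (subst (k ≤_) (≡.sym (hd-bump j L)) (≤-trans k≤j (m≤m⊔n j (hd L))))
                    (subst (_< i) (≡.sym (hd-bump j L)) (⊔-lub j<i h<i))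
  knuth₂-columns {i} {j} {k} 1≤k k≤j j<i a (x ∷ L) (_ , d) | no i≰x =
    ≅-skip (j ∷ k ∷ i ∷ []) (j ∷ i ∷ k ∷ []) (j≤x ∷ k≤x ∷ i≤x ∷ []) (j≤x ∷ i≤x ∷ k≤x ∷ [])
           (knuth₂-columns 1≤k k≤j j<i a L d)
    where
    i≤x = ≮⇒≥ i≰x
    j≤x = ≤-trans (<⇒≤ j<i) i≤x
    k≤x = ≤-trans k≤j j≤x
  knuth₂-columns 1≤k k≤j j<i a [] _ | no 0≮i =
    ⊥-elim (0≮i (<-≤-trans 1≤k (≤-trans k≤j (<⇒≤ j<i))))

  pushTerm : ℕ → Carrier × List ℕ → Carrier × List ℕ
  pushTerm j (a , μ) = a * prodFrom (minRow j μ) (j ∸ minRow j μ) , push j μ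

  pushTerm-fromCols : ∀ {j a} L → 1 ≤ j → Decreasing L →
                      pushTerm j (a , fromCols L) ≡ map₂ fromCols (insertCol j (a , L))
  pushTerm-fromCols {j} {a} L 1≤j d =
    cong₂ _,_ (cong (λ m → a * prodFrom m (j ∸ m)) (minRow-fromCols L 1≤j d)) (push-fromCols L 1≤j d)

  pushWord : List ℕ → Carrier × List ℕ → Carrier × List ℕ
  pushWord [] X = X
  pushWord (j ∷ w) X = pushWord w (pushTerm j X)

  pushWord-fromCols : ∀ {a L} w → All (1 ≤_) w → Decreasing L →
                      pushWord w (a , fromCols L) ≡ map₂ fromCols (insertWord w (a , L))
  pushWord-fromCols [] [] _ = ≡.refl
  pushWord-fromCols {L = L} (j ∷ w) (1≤j ∷ ps) d =
    ≡.trans (cong (pushWord w) (pushTerm-fromCols L 1≤j d))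
            (pushWord-fromCols w ps (bump-decreasing j L d))

  uWord : List ℕ → Vect → Vect
  uWord [] v = v
  uWord (j ∷ w) v = uWord w (u j v)

  uWord-map : ∀ w v → uWord w v ≡ map (pushWord w) v
  uWord-map [] v = ≡.sym (map-id v)
  uWord-map (j ∷ w) v = ≡.trans (uWord-map w (u j v)) (≡.sym (map-∘ v))

  coeff-map-≅ : ∀ λ′ {f g : Carrier × List ℕ → Carrier × List ℕ} v → All (λ t → f t ≅ g t) v →
                coeff λ′ (map f v) ≈ coeff λ′ (map g v)
  coeff-map-≅ λ′ [] [] = refl
  coeff-map-≅ λ′ {f} {g} (t ∷ v) (ft≅gt ∷ ps) = head ft≅gt (coeff-map-≅ λ′ v ps)
    where
    head : ∀ {X Y r₁ r₂} → X ≅ Y → coeff λ′ r₁ ≈ coeff λ′ r₂ →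
           coeff λ′ (X ∷ r₁) ≈ coeff λ′ (Y ∷ r₂)
    head {_ , μ} (a≈b , ≡.refl) rest with ≡-dec _≟_ μ λ′
    ... | yes _ = +-cong a≈b rest
    ... | no _ = rest

  uWord-≋ : ∀ {w w′} → All (1 ≤_) w → All (1 ≤_) w′ → SameInsertion w w′ →
            ∀ v → IsVect v → uWord w v ≋ uWord w′ v
  uWord-≋ {w} {w′} ps ps′ same v iv λ′ _ rewrite uWord-map w v | uWord-map w′ v =
    coeff-map-≅ λ′ v (All.map termwise iv)
    where
    termwise : ∀ {t} → IsPartition (proj₂ t) → pushWord w t ≅ pushWord w′ t
    termwise {a , _} ip with partition-fromCols ip
    ... | L , d , ≡.refl =
      ≡.subst₂ _≅_ (≡.sym (pushWord-fromCols w ps d)) (≡.sym (pushWord-fromCols w′ ps′ d))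
                   (proj₁ (same a L d) , cong fromCols (proj₂ (same a L d)))

  coeff-++ : ∀ λ′ xs ys → coeff λ′ (xs ++ ys) ≈ coeff λ′ xs +ᵣ coeff λ′ ys
  coeff-++ λ′ [] ys = sym (+-identityˡ _)
  coeff-++ λ′ ((a , μ) ∷ xs) ys with ≡-dec _≟_ μ λ′
  ... | yes _ = trans (+-congˡ (coeff-++ λ′ xs ys)) (sym (+ᵣ-assoc _ _ _))
  ... | no _ = coeff-++ λ′ xs ys

  ≋-sym : ∀ {v w} → v ≋ w → w ≋ v
  ≋-sym v≋w λ′ p = sym (v≋w λ′ p)

  ≋-++ : ∀ {v v′ w w′} → v ≋ v′ → w ≋ w′ → (v ++ w) ≋ (v′ ++ w′)
  ≋-++ {v} {v′} {w} {w′} v≋v′ w≋w′ λ′ p = begin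
    coeff λ′ (v ++ w)            ≈⟨ coeff-++ λ′ v w ⟩
    coeff λ′ v +ᵣ coeff λ′ w     ≈⟨ +-cong (v≋v′ λ′ p) (w≋w′ λ′ p) ⟩
    coeff λ′ v′ +ᵣ coeff λ′ w′   ≈⟨ sym (coeff-++ λ′ v′ w′) ⟩
    coeff λ′ (v′ ++ w′)          ∎

  knuth₁ : (i j k : ℕ) → 1 ≤ k → k < j → j ≤ i → (v : Vect) → IsVect v →
           u j (u i (u k v)) ≋ u j (u k (u i v))
  knuth₁ i j k 1≤k k<j j≤i =
    uWord-≋ (1≤k ∷ 1≤i ∷ 1≤j ∷ []) (1≤i ∷ 1≤k ∷ 1≤j ∷ []) (knuth₁-columns 1≤k k<j j≤i)
    where
    1≤j = ≤-trans 1≤k (<⇒≤ k<j)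
    1≤i = ≤-trans 1≤j j≤i

  knuth₂ : (i j k : ℕ) → 1 ≤ k → k ≤ j → j < i → (v : Vect) → IsVect v →
           u i (u k (u j v)) ≋ u k (u i (u j v))
  knuth₂ i j k 1≤k k≤j j<i =
    uWord-≋ (1≤j ∷ 1≤k ∷ 1≤i ∷ []) (1≤j ∷ 1≤i ∷ 1≤k ∷ []) (knuth₂-columns 1≤k k≤j j<i)
    where
    1≤j = ≤-trans 1≤k k≤j
    1≤i = ≤-trans 1≤j (<⇒≤ j<i)

  knuth₃ : (i : ℕ) → 1 ≤ i → (v : Vect) → IsVect v →
           (u i ⊕ u (suc i)) (u (suc i) (u i v)) ≋ u (suc i) (u i ((u i ⊕ u (suc i)) v))
  knuth₃ i 1≤i v iv =
    subst (λ z → (u i ⊕ u (suc i)) X ≋ z) (≡.sym u-++) (≋-++ {u i X} {Y} {u (suc i) X} {Z} first second)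
    where
    X = u (suc i) (u i v)
    Y = u (suc i) (u i (u i v))
    Z = u (suc i) (u i (u (suc i) v))
    first : u i X ≋ Y
    first = ≋-sym {Y} {u i X} (knuth₂ (suc i) i i 1≤i ≤-refl (n<1+n i) v iv)
    second : u (suc i) X ≋ Z
    second = knuth₁ (suc i) (suc i) i 1≤i (n<1+n i) ≤-refl v iv
    u-++ : u (suc i) (u i (u i v ++ u (suc i) v)) ≡ Y ++ Z
    u-++ = ≡.trans (cong (u (suc i)) (map-++ _ (u i v) (u (suc i) v)))
                   (map-++ _ (u i (u i v)) (u i (u (suc i) v)))

lemma3p14 : {c ℓ : Level} (R : CommutativeRing c ℓ) → IsField R → CharZero R →
    (β : ℕ → CommutativeRing.Carrier R) →
    let open KP R β in
    ((i j k : ℕ) → 1 ≤ k → k < j → j ≤ i → (v : Vect) → IsVect v →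
      u j (u i (u k v)) ≋ u j (u k (u i v)))
    × ((i j k : ℕ) → 1 ≤ k → k ≤ j → j < i → (v : Vect) → IsVect v →
      u i (u k (u j v)) ≋ u k (u i (u j v)))
    × ((i : ℕ) → 1 ≤ i → (v : Vect) → IsVect v →
      (u i ⊕ u (suc i)) (u (suc i) (u i v)) ≋ u (suc i) (u i ((u i ⊕ u (suc i)) v)))
lemma3p14 R _ _ β = knuth₁ R β , knuth₂ R β , knuth₃ R β
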